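{- For all $r,\ell\in\mathbb N$ (with $r,\ell\ge1$), $$\partial_{2r+1}(F_\ell\mathcal B_{2,3})\subseteq\mathbb Q\langle X\rangle_{2r+1}\otimes F_{\ell-1}\mathcal B_{2,3}.$$
   Context: Let $X=\{x_0,x_1\}$ and let $\mathbb Q\langle X\rangle$ be the free non-commutative $\mathbb Q$-algebra on $X$, with word basis, empty word $\mathbf 1$, weight equal to length, and weight-$m$ part $\mathbb Q\langle X\rangle_m$. Let $S(\varepsilon_1\cdots\varepsilon_n)=(-1)^n\varepsilon_n\cdots\varepsilon_1$. For $a,b\in X$ and $f\in\mathbb Q\langle X\rangle$ set $I(a;f;b)=f$ if $(a,b)=(x_1,x_0)$, $S(f)$ if $(a,b)=(x_0,x_1)$, and $(\text{coefficient of }\mathbf 1\text{ in }f)\mathbf 1$ if $a=b$. For $r\ge1$ define $\partial_{2r+1}:\mathbb Q\langle X\rangle\to\mathbb Q\langle X\rangle_{2r+1}\otimes\mathbb Q\langle X\rangle$ on words $w=\varepsilon_1\cdots\varepsilon_N$ by $$\partial_{2r+1}(w)=\sum_{j=0}^{N-2r-1}I(\varepsilon_j;\varepsilon_{j+1}\cdots\varepsilon_{j+2r+1};\varepsilon_{j+2r+2})\otimes\varepsilon_1\cdots\varepsilon_j\varepsilon_{j+2r+2}\cdots\varepsilon_N,$$ where $\varepsilon_0=x_1$ and $\varepsilon_{N+1}=x_0$. $\mathcal B_{2,3}$ is the span of words that are concatenations of blocks $x_0x_1$ and $x_0x_0x_1$. The level of such a word is its number of blocks $x_0x_0x_1$.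 $F_\ell\mathcal B_{2,3}$ is the span of such words of level $\le\ell$, with $F_{ -1}\mathcal B_{2,3}=0$. -}

module Defs where

open import Data.Nat using (ℕ; zero; suc; _+_; _*_; _≤ᵇ_)
open import Data.Bool using (Bool; true; false; if_then_else_)
open import Data.List using (List; []; _∷_; _++_; take; drop; length; reverse; foldr)
open import Data.List.Properties using (≡-dec)
open import Data.Product using (_×_; _,_)
open import Data.Rational using (ℚ; 0ℚ; 1ℚ; -_) renaming (_+_ to _+ℚ_)
open import Relation.Nullary using (yes; no; Dec)
open import Relation.Binary.PropositionalEquality using (_≡_; refl)

data Letter : Set where
  x₀ x₁ : Letter

_≟L_ : (a b : Letter) → Dec (a ≡ b)
x₀ ≟L x₀ = yes refl
x₀ ≟L x₁ = no λ ()
x₁ ≟L x₀ = no λ ()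
x₁ ≟L x₁ = yes refl

-- words (basis of Q⟨X⟩); the empty word is 𝟏, weight = length
Word : Set
Word = List Letter

_≟W_ : (u v : Word) → Dec (u ≡ v)
_≟W_ = ≡-dec _≟L_

QX : Set
QX = List (ℚ × Word)

QX⊗QX : Set
QX⊗QX = List (ℚ × Word × Word)

coeff : QX → Word → ℚ
coeff [] w = 0ℚ
coeff ((q , u) ∷ f) w with u ≟W w
... | yes _ = q +ℚ coeff f w
... | no  _ = coeff f w

coeff⊗ : QX⊗QX → Word → Word → ℚ
coeff⊗ [] u v = 0ℚ
coeff⊗ ((q , u' , v') ∷ t) u v with u' ≟W u | v' ≟W v
... | yes _ | yes _ = q +ℚ coeff⊗ t u v
... | _     | _     = coeff⊗ t u v

sign : ℕ → ℚ
sign zero = 1ℚ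
sign (suc n) = - sign n

S : Word → QX
S u = (sign (length u) , reverse u) ∷ []

const𝟏 : Word → QX
const𝟏 [] = (1ℚ , []) ∷ []
const𝟏 (_ ∷ _) = []

I : Letter → Word → Letter → QX
I x₁ u x₀ = (1ℚ , u) ∷ []
I x₀ u x₁ = S u
I x₀ u x₀ = const𝟏 u
I x₁ u x₁ = const𝟏 u

_⊗w_ : QX → Word → QX⊗QX
[] ⊗w v = []
((q , u) ∷ f) ⊗w v = (q , u , v) ∷ (f ⊗w v)

headOr : Letter → Word → Letter
headOr d [] = d
headOr d (a ∷ _) = a

-- Arguments: m, the letter ε_j (x₁ if j = 0),
-- the prefix ε₁⋯ε_j, the suffix ε_{j+1}⋯ε_N.
∂aux : ℕ → Letter → Word → Word → QX⊗QX
∂aux m a p [] = []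
∂aux m a p (c ∷ s) =
  (if m ≤ᵇ length (c ∷ s)
   then I a (take m (c ∷ s)) (headOr x₀ (drop m (c ∷ s))) ⊗w (p ++ drop m (c ∷ s))
   else [])
  ++ ∂aux m c (p ++ (c ∷ [])) s

-- ∂_m on a word w = ε₁⋯ε_N, with ε₀ = x₁ and ε_{N+1} = x₀ (used with m = 2r+1 ≥ 1)
∂w : ℕ → Word → QX⊗QX
∂w m w = ∂aux m x₁ [] w

scale : ℚ → QX⊗QX → QX⊗QX
scale q [] = []
scale q ((q' , u , v) ∷ t) = (q Data.Rational.* q' , u , v) ∷ scale q t

∂ : ℕ → QX → QX⊗QX
∂ m [] = []
∂ m ((q , w) ∷ f) = scale q (∂w m w) ++ ∂ m f

-- Blocks w l : w is a concatenation of blocks x₀x₁ and x₀x₀x₁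
-- with exactly l blocks x₀x₀x₁ (the level)
data Blocks : Word → ℕ → Set where
  nil : Blocks [] 0
  b2  : ∀ {w l} → Blocks w l → Blocks (x₀ ∷ x₁ ∷ w) l
  b3  : ∀ {w l} → Blocks w l → Blocks (x₀ ∷ x₀ ∷ x₁ ∷ w) (suc l)

-- By linearity it suffices to consider one word w of level ≤ ℓ.  A term of
-- ∂_{2r+1}(w) excises a window t of odd length 2r+1 from w whose flanking
-- letters ε_j, ε_{j+2r+2} differ.  If w is a concatenation of blocks x₀x₁ and
-- x₀x₀x₁, such a cut either starts at a block boundary and ends before an x₀
-- (or at the end), or starts after an x₀ and ends just before the x₁ closing a
-- block.  In both cases the remaining word is again made of blocks and its
-- level is lower by some d with d ≡ |t| (mod 2); as |t| is odd, d ≥ 1.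
module Submission where

open import Defs
open import Data.Bool using (true; if_then_else_; T)
open import Data.Empty using (⊥-elim)
open import Data.List using ([]; _∷_; _++_; length; take; drop)
import Data.List.Properties as List
open import Data.List.Membership.Propositional using (_∈_)
open import Data.List.Membership.Propositional.Properties using (∈-++⁻)
open import Data.List.Relation.Unary.Any using (here; there)
open import Data.Nat using (ℕ; suc; _+_; _*_; _≤_; _<_; _∸_; z≤n; s≤s; _≤ᵇ_; NonZero; >-nonZero; ≢-nonZero⁻¹; parity)
import Data.Nat.Properties as ℕ
open import Data.Parity.Base as ℙ using (1ℙ)
open import Data.Parity.Properties using (+-homo-+; *-homo-*)
open import Data.Product using (_×_; ∃-syntax; _,_)
open import Data.Rational using (ℚ; 0ℚ) renaming (_+_ to _+ℚ_; _*_ to _*ℚ_)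
import Data.Rational.Properties as ℚ
open import Data.Sum using (_⊎_; inj₁; inj₂)
open import Relation.Nullary using (yes; no)
open import Relation.Binary.PropositionalEquality

coeff⊗-++ : ∀ A B u v → coeff⊗ (A ++ B) u v ≡ coeff⊗ A u v +ℚ coeff⊗ B u v
coeff⊗-++ [] B u v = sym (ℚ.+-identityˡ _)
coeff⊗-++ ((q , u' , v') ∷ A) B u v with u' ≟W u | v' ≟W v
... | yes _ | yes _ = trans (cong (q +ℚ_) (coeff⊗-++ A B u v)) (sym (ℚ.+-assoc q _ _))
... | yes _ | no _  = coeff⊗-++ A B u v
... | no _  | _     = coeff⊗-++ A B u v

coeff⊗-scale : ∀ q A u v → coeff⊗ (scale q A) u v ≡ q *ℚ coeff⊗ A u v
coeff⊗-scale q [] u v = sym (ℚ.*-zeroʳ q)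
coeff⊗-scale q ((q' , u' , v') ∷ A) u v with u' ≟W u | v' ≟W v
... | yes _ | yes _ = trans (cong (q *ℚ q' +ℚ_) (coeff⊗-scale q A u v)) (sym (ℚ.*-distribˡ-+ q q' _))
... | yes _ | no _  = coeff⊗-scale q A u v
... | no _  | _     = coeff⊗-scale q A u v

coeff⊗≢0⇒∈ : ∀ A u v → coeff⊗ A u v ≢ 0ℚ → ∃[ q ] (q , u , v) ∈ A
coeff⊗≢0⇒∈ [] u v c≢0 = ⊥-elim (c≢0 refl)
coeff⊗≢0⇒∈ ((q , u' , v') ∷ A) u v c≢0 with u' ≟W u | v' ≟W v
... | yes refl | yes refl = q , here refl
... | yes _    | no _     = let q' , q'∈ = coeff⊗≢0⇒∈ A u v c≢0 in q' , there q'∈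
... | no _     | _        = let q' , q'∈ = coeff⊗≢0⇒∈ A u v c≢0 in q' , there q'∈

deleteWord : Word → QX → QX
deleteWord w [] = []
deleteWord w ((q , w') ∷ f) with w' ≟W w
... | yes _ = deleteWord w f
... | no _  = (q , w') ∷ deleteWord w f

coeff-deleteWord-self : ∀ w f → coeff (deleteWord w f) w ≡ 0ℚ
coeff-deleteWord-self w [] = refl
coeff-deleteWord-self w ((q , w') ∷ f) with w' ≟W w
... | yes _ = coeff-deleteWord-self w f
... | no w'≢w with w' ≟W w
...   | yes w'≡w = ⊥-elim (w'≢w w'≡w)
...   | no _     = coeff-deleteWord-self w f

coeff-deleteWord-other : ∀ w f {w″} → w″ ≢ w → coeff (deleteWord w f) w″ ≡ coeff f w″
coeff-deleteWord-other w [] w″≢w = refl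
coeff-deleteWord-other w ((q , w') ∷ f) {w″} w″≢w with w' ≟W w
... | yes refl with w' ≟W w″
...   | yes refl = ⊥-elim (w″≢w refl)
...   | no _     = coeff-deleteWord-other w f w″≢w
coeff-deleteWord-other w ((q , w') ∷ f) {w″} w″≢w | no _ with w' ≟W w″
...   | yes _ = cong (q +ℚ_) (coeff-deleteWord-other w f w″≢w)
...   | no _  = coeff-deleteWord-other w f w″≢w

length-deleteWord : ∀ w f → length (deleteWord w f) ≤ length f
length-deleteWord w [] = z≤n
length-deleteWord w ((q , w') ∷ f) with w' ≟W w
... | yes _ = ℕ.m≤n⇒m≤1+n (length-deleteWord w f)
... | no _  = s≤s (length-deleteWord w f)

length-deleteWord-head : ∀ q w f → length (deleteWord w ((q , w) ∷ f)) ≤ length f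
length-deleteWord-head q w f with w ≟W w
... | yes _   = length-deleteWord w f
... | no w≢w = ⊥-elim (w≢w refl)

module _ (G : Word → ℚ) where

  linear : QX → ℚ
  linear [] = 0ℚ
  linear ((q , w) ∷ f) = q *ℚ G w +ℚ linear f

  linear-deleteWord : ∀ w f → linear f ≡ coeff f w *ℚ G w +ℚ linear (deleteWord w f)
  linear-deleteWord w [] = sym (trans (cong (_+ℚ 0ℚ) (ℚ.*-zeroˡ (G w))) (ℚ.+-identityʳ 0ℚ))
  linear-deleteWord w ((q , w') ∷ f) with w' ≟W w
  ... | yes refl = begin
      q *ℚ G w +ℚ linear f
        ≡⟨ cong (q *ℚ G w +ℚ_) (linear-deleteWord w f) ⟩
      q *ℚ G w +ℚ (coeff f w *ℚ G w +ℚ linear (deleteWord w f))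
        ≡⟨ ℚ.+-assoc (q *ℚ G w) (coeff f w *ℚ G w) _ ⟨
      q *ℚ G w +ℚ coeff f w *ℚ G w +ℚ linear (deleteWord w f)
        ≡⟨ cong (_+ℚ linear (deleteWord w f)) (ℚ.*-distribʳ-+ (G w) q _) ⟨
      (q +ℚ coeff f w) *ℚ G w +ℚ linear (deleteWord w f)
        ∎
    where open ≡-Reasoning
  ... | no _ = begin
      q *ℚ G w' +ℚ linear f
        ≡⟨ cong (q *ℚ G w' +ℚ_) (linear-deleteWord w f) ⟩
      q *ℚ G w' +ℚ (coeff f w *ℚ G w +ℚ linear (deleteWord w f))
        ≡⟨ ℚ.+-assoc (q *ℚ G w') (coeff f w *ℚ G w) _ ⟨
      q *ℚ G w' +ℚ coeff f w *ℚ G w +ℚ linear (deleteWord w f)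
        ≡⟨ cong (_+ℚ linear (deleteWord w f)) (ℚ.+-comm (q *ℚ G w') _) ⟩
      coeff f w *ℚ G w +ℚ q *ℚ G w' +ℚ linear (deleteWord w f)
        ≡⟨ ℚ.+-assoc (coeff f w *ℚ G w) (q *ℚ G w') _ ⟩
      coeff f w *ℚ G w +ℚ (q *ℚ G w' +ℚ linear (deleteWord w f))
        ∎
    where open ≡-Reasoning

  -- n bounds the number of terms: deleteWord w f is not a structural subterm of f.
  linear≢0⇒support : ∀ n f → length f ≤ n → linear f ≢ 0ℚ →
                     ∃[ w ] (coeff f w ≢ 0ℚ × G w ≢ 0ℚ)
  linear≢0⇒support n [] _ f≢0 = ⊥-elim (f≢0 refl)
  linear≢0⇒support (suc n) f@((q , w) ∷ f') (s≤s |f'|≤n) f≢0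
    with coeff f w *ℚ G w ℚ.≟ 0ℚ
  ... | no cG≢0 = w , (λ c≡0 → cG≢0 (trans (cong (_*ℚ G w) c≡0) (ℚ.*-zeroˡ (G w))))
                    , (λ G≡0 → cG≢0 (trans (cong (coeff f w *ℚ_) G≡0) (ℚ.*-zeroʳ (coeff f w))))
  ... | yes cG≡0
    with linear≢0⇒support n (deleteWord w f) (ℕ.≤-trans (length-deleteWord-head q w f') |f'|≤n)
           (λ rest≡0 → f≢0 (trans (linear-deleteWord w f)
                                  (trans (cong₂ _+ℚ_ cG≡0 rest≡0) (ℚ.+-identityʳ 0ℚ))))
  ... | w″ , c≢0 , G≢0 with w″ ≟W w
  ...   | yes refl = ⊥-elim (c≢0 (coeff-deleteWord-self w f))
  ...   | no w″≢w  = w″ , (λ c≡0 → c≢0 (trans (coeff-deleteWord-other w f w″≢w) c≡0)) , G≢0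

coeff⊗-∂ : ∀ m f u v → coeff⊗ (∂ m f) u v ≡ linear (λ w → coeff⊗ (∂w m w) u v) f
coeff⊗-∂ m [] u v = refl
coeff⊗-∂ m ((q , w) ∷ f) u v =
  trans (coeff⊗-++ (scale q (∂w m w)) (∂ m f) u v)
        (cong₂ _+ℚ_ (coeff⊗-scale q (∂w m w) u v) (coeff⊗-∂ m f u v))

lastOr : Letter → Word → Letter
lastOr d [] = d
lastOr d (a ∷ p) = lastOr a p

∈-⊗w : ∀ f v' {q u v} → (q , u , v) ∈ f ⊗w v' → v ≡ v' × (q , u) ∈ f
∈-⊗w ((q , u) ∷ f) v' (here refl) = refl , here refl
∈-⊗w ((q , u) ∷ f) v' (there q∈) = let v≡v' , q∈f = ∈-⊗w f v' q∈ in v≡v' , there q∈f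

∈-const𝟏 : ∀ t {q u} → (q , u) ∈ const𝟏 t → u ≡ t × t ≡ []
∈-const𝟏 [] (here refl) = refl , refl

∈-I⊗w : ∀ a t b v' {q u v} → (q , u , v) ∈ I a t b ⊗w v' →
        v ≡ v' × length u ≡ length t × (a ≢ b ⊎ t ≡ [])
∈-I⊗w x₁ t x₀ v' q∈ with ∈-⊗w _ v' q∈
... | v≡v' , here refl = v≡v' , refl , inj₁ λ ()
∈-I⊗w x₀ t x₁ v' q∈ with ∈-⊗w _ v' q∈
... | v≡v' , here refl = v≡v' , List.length-reverse t , inj₁ λ ()
∈-I⊗w x₀ t x₀ v' q∈ with ∈-⊗w _ v' q∈
... | v≡v' , q∈c with ∈-const𝟏 t q∈c
...   | refl , refl = v≡v' , refl , inj₂ refl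
∈-I⊗w x₁ t x₁ v' q∈ with ∈-⊗w _ v' q∈
... | v≡v' , q∈c with ∈-const𝟏 t q∈c
...   | refl , refl = v≡v' , refl , inj₂ refl

-- flanks-differ compares the letters ε_j and ε_{j+m+1} around the window.
record Window (m : ℕ) (a : Letter) (p s u v : Word) : Set where
  constructor window
  field
    left middle right : Word
    s≡ : s ≡ left ++ middle ++ right
    v≡ : v ≡ p ++ left ++ right
    |middle|≡m : length middle ≡ m
    |u|≡m : length u ≡ m
    flanks-differ : lastOr a left ≢ headOr x₀ right

length-take-≤ᵇ : ∀ m (xs : Word) → (m ≤ᵇ length xs) ≡ true → length (take m xs) ≡ m
length-take-≤ᵇ m xs m≤ᵇ = trans (List.length-take m xs)
  (ℕ.m≤n⇒m⊓n≡m (ℕ.≤ᵇ⇒≤ m (length xs) (subst T (sym m≤ᵇ) _)))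

∈-∂aux⇒Window : ∀ m .{{_ : NonZero m}} a p s {q u v} → (q , u , v) ∈ ∂aux m a p s →
                Window m a p s u v
∈-∂aux⇒Window m a p (c ∷ s) q∈ with ∈-++⁻ (if m ≤ᵇ length (c ∷ s)
   then I a (take m (c ∷ s)) (headOr x₀ (drop m (c ∷ s))) ⊗w (p ++ drop m (c ∷ s))
   else []) q∈
... | inj₂ q∈rest with ∈-∂aux⇒Window m c (p ++ c ∷ []) s q∈rest
...   | window l t r refl refl |t| |u| ne =
        window (c ∷ l) t r refl (List.++-assoc p (c ∷ []) (l ++ r)) |t| |u| ne
∈-∂aux⇒Window m a p (c ∷ s) q∈ | inj₁ q∈here with m ≤ᵇ length (c ∷ s) in m≤ᵇ
... | true with ∈-I⊗w a (take m (c ∷ s)) (headOr x₀ (drop m (c ∷ s))) (p ++ drop m (c ∷ s)) q∈here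
...   | _ , _ , inj₂ t≡[] =
        ⊥-elim (≢-nonZero⁻¹ m (trans (sym (length-take-≤ᵇ m (c ∷ s) m≤ᵇ)) (cong length t≡[])))
...   | v≡ , |u|≡|t| , inj₁ a≢b =
        window [] (take m (c ∷ s)) (drop m (c ∷ s)) (sym (List.take++drop≡id m (c ∷ s))) v≡
               (length-take-≤ᵇ m (c ∷ s) m≤ᵇ) (trans |u|≡|t| (length-take-≤ᵇ m (c ∷ s) m≤ᵇ)) a≢b

parity-suc : ∀ m n → parity m ≡ parity n → parity (suc m) ≡ parity (suc n)
parity-suc m n eq = trans (+-homo-+ 1 m) (trans (cong (1ℙ ℙ.+_) eq) (sym (+-homo-+ 1 n)))

parity[2r+1]≡1ℙ : ∀ r → parity (2 * r + 1) ≡ 1ℙ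
parity[2r+1]≡1ℙ r = trans (+-homo-+ (2 * r) 1) (cong (ℙ._+ 1ℙ) (*-homo-* 2 r))

m<odd+m : ∀ {d} m → parity d ≡ 1ℙ → m < d + m
m<odd+m {suc d} m _ = ℕ.m<n+m m (s≤s z≤n)

-- The prefix t need not consist of whole blocks: it may end inside a block
-- x₀x₀x₁, which then becomes x₀x₁.
Blocks-dropPrefix : ∀ t s {k} → Blocks (t ++ s) k → x₁ ≢ headOr x₀ s →
  ∃[ d ] ∃[ k' ] (Blocks s k' × k ≡ d + k' × parity (length t) ≡ parity d)
Blocks-dropPrefix [] s {k} B _ = 0 , k , B , refl , refl
Blocks-dropPrefix (x₀ ∷ []) (x₀ ∷ x₁ ∷ w) (b3 B) _ = 1 , _ , b2 B , refl , refl
Blocks-dropPrefix (x₀ ∷ []) (x₁ ∷ w) (b2 B) x₁≢x₁ = ⊥-elim (x₁≢x₁ refl)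
Blocks-dropPrefix (x₀ ∷ x₀ ∷ []) (x₁ ∷ w) (b3 B) x₁≢x₁ = ⊥-elim (x₁≢x₁ refl)
Blocks-dropPrefix (x₀ ∷ x₁ ∷ t) s (b2 B) x₁≢s₀ with Blocks-dropPrefix t s B x₁≢s₀
... | d , k' , B' , refl , par = d , k' , B' , refl , par
Blocks-dropPrefix (x₀ ∷ x₀ ∷ x₁ ∷ t) s (b3 B) x₁≢s₀ with Blocks-dropPrefix t s B x₁≢s₀
... | d , k' , B' , refl , par = suc d , k' , B' , refl , parity-suc (length t) d par

Blocks-dropPrefix-x₁ : ∀ t r {k} → Blocks (t ++ x₁ ∷ r) k →
  ∃[ d ] ∃[ k' ] (Blocks r k' × k ≡ d + k' × parity (suc (length t)) ≡ parity d)
Blocks-dropPrefix-x₁ (x₀ ∷ []) r (b2 B) = 0 , _ , B , refl , refl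
Blocks-dropPrefix-x₁ (x₀ ∷ x₀ ∷ []) r (b3 B) = 1 , _ , B , refl , refl
Blocks-dropPrefix-x₁ (x₀ ∷ x₁ ∷ t) r (b2 B) with Blocks-dropPrefix-x₁ t r B
... | d , k' , B' , refl , par = d , k' , B' , refl , par
Blocks-dropPrefix-x₁ (x₀ ∷ x₀ ∷ x₁ ∷ t) r (b3 B) with Blocks-dropPrefix-x₁ t r B
... | d , k' , B' , refl , par = suc d , k' , B' , refl , parity-suc (suc (length t)) d par

Blocks-excise-x₀ : ∀ t r {k} → Blocks (x₀ ∷ t ++ x₁ ∷ r) k → parity (length t) ≡ 1ℙ →
  ∃[ k' ] (Blocks (x₀ ∷ x₁ ∷ r) k' × k' < k)
Blocks-excise-x₀ t r B odd with Blocks-dropPrefix-x₁ (x₀ ∷ t) r B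
... | d , k' , B' , refl , par = k' , b2 B' , m<odd+m k' (trans (sym par) odd)

Blocks-excise-x₀x₀ : ∀ t r {k} → Blocks (x₀ ∷ x₀ ∷ t ++ x₁ ∷ r) k → parity (length t) ≡ 1ℙ →
  ∃[ k' ] (Blocks (x₀ ∷ x₀ ∷ x₁ ∷ r) k' × k' < k)
Blocks-excise-x₀x₀ (x₁ ∷ t) r (b3 B) odd with Blocks-dropPrefix-x₁ t r B
... | d , k' , B' , refl , par = suc k' , b3 B' , s≤s (m<odd+m k' (trans (sym par) odd))

Blocks-excise : ∀ p t s {k} → Blocks (p ++ t ++ s) k → parity (length t) ≡ 1ℙ →
  lastOr x₁ p ≢ headOr x₀ s → ∃[ k' ] (Blocks (p ++ s) k' × k' < k)
Blocks-excise [] t s B odd x₁≢s₀ with Blocks-dropPrefix t s B x₁≢s₀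
... | d , k' , B' , refl , par = k' , B' , m<odd+m k' (trans (sym par) odd)
Blocks-excise (x₀ ∷ []) t (x₁ ∷ r) B odd _ = Blocks-excise-x₀ t r B odd
Blocks-excise (x₀ ∷ []) t [] B odd x₀≢x₀ = ⊥-elim (x₀≢x₀ refl)
Blocks-excise (x₀ ∷ []) t (x₀ ∷ r) B odd x₀≢x₀ = ⊥-elim (x₀≢x₀ refl)
Blocks-excise (x₀ ∷ x₀ ∷ []) t (x₁ ∷ r) B odd _ = Blocks-excise-x₀x₀ t r B odd
Blocks-excise (x₀ ∷ x₀ ∷ []) t [] B odd x₀≢x₀ = ⊥-elim (x₀≢x₀ refl)
Blocks-excise (x₀ ∷ x₀ ∷ []) t (x₀ ∷ r) B odd x₀≢x₀ = ⊥-elim (x₀≢x₀ refl)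
Blocks-excise (x₀ ∷ x₁ ∷ p) t s (b2 B) odd ne with Blocks-excise p t s B odd ne
... | k' , B' , k'<k = k' , b2 B' , k'<k
Blocks-excise (x₀ ∷ x₀ ∷ x₁ ∷ p) t s (b3 B) odd ne with Blocks-excise p t s B odd ne
... | k' , B' , k'<k = suc k' , b3 B' , s≤s k'<k

lemma4p6 : (r ℓ : ℕ) → 1 ≤ r → 1 ≤ ℓ → (f : QX) →
    (∀ w → coeff f w ≢ 0ℚ → ∃[ k ] (Blocks w k × k ≤ ℓ)) →
    ∀ u v → coeff⊗ (∂ (2 * r + 1) f) u v ≢ 0ℚ →
      length u ≡ 2 * r + 1 × ∃[ k ] (Blocks v k × k ≤ ℓ ∸ 1)
lemma4p6 r ℓ _ _ f f∈Fℓ u v ∂f≢0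
  with linear≢0⇒support (λ w → coeff⊗ (∂w (2 * r + 1) w) u v) (length f) f ℕ.≤-refl
         (λ eq → ∂f≢0 (trans (coeff⊗-∂ (2 * r + 1) f u v) eq))
... | w , fw≢0 , ∂w≢0 with f∈Fℓ w fw≢0 | coeff⊗≢0⇒∈ (∂w (2 * r + 1) w) u v ∂w≢0
... | k , Bw , k≤ℓ | _ , term
  with ∈-∂aux⇒Window (2 * r + 1) {{>-nonZero (ℕ.m≤n+m 1 (2 * r))}} x₁ [] w term
... | window p t s refl refl |t| |u| flanks
  with Blocks-excise p t s Bw (trans (cong parity |t|) (parity[2r+1]≡1ℙ r)) flanks
... | k' , Bv , k'<k = |u| , k' , Bv , ℕ.∸-monoˡ-≤ 1 (ℕ.≤-trans k'<k k≤ℓ)
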